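{- Let $G$ be a simple graph with adjacency matrix $A$. If $\mathrm{LCP}(A+I,-\mathbf{e})$ is w-unique, then $\mathbf{e}^\top x$ is constant over $x\in\mathrm{SOL}(G)$; consequently $G$ is well-covered.
   Context: $\mathrm{SOL}(G)$ is the solution set of $\mathrm{LCP}(A+I,-\mathbf{e})$: vectors $x$ with $x\ge0$, $(A+I)x\ge\mathbf{e}$, $x^\top((A+I)x-\mathbf{e})=0$ ($I$ identity, $\mathbf{e}$ all-ones). An $\mathrm{LCP}(M,q)$ is w-unique if the vector $Mx+q$ is the same for all solutions $x$. A graph is well-covered if all its maximal independent sets have the same cardinality.
   Formalization: The solution vectors of $\mathrm{LCP}(A+I,-\mathbf{e})$, both in $\mathrm{SOL}(G)$ and in the w-uniqueness hypothesis, are taken over ℚ. -}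

module Defs where

open import Data.Nat using (ℕ; zero; suc)
open import Data.Bool using (Bool; true; false; if_then_else_)
open import Data.Fin using (Fin; zero; suc)
open import Data.Fin.Properties using (_≟_)
open import Data.Fin.Subset using (Subset; _∈_; _⊆_; ∣_∣)
open import Data.Rational using (ℚ; 0ℚ; 1ℚ; _+_; _*_; -_; _≤_)
open import Data.Product using (_×_)
open import Relation.Nullary using (yes; no)
open import Relation.Binary.PropositionalEquality using (_≡_)

record SimpleGraph (n : ℕ) : Set where
  field
    Adj    : Fin n → Fin n → Bool
    sym    : ∀ i j → Adj i j ≡ Adj j i
    irrefl : ∀ i → Adj i i ≡ false
open SimpleGraph public

Vecℚ : ℕ → Set
Vecℚ n = Fin n → ℚ

Matℚ : ℕ → Set
Matℚ n = Fin n → Fin n → ℚ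

sumℚ : ∀ {n} → Vecℚ n → ℚ
sumℚ {zero}  f = 0ℚ
sumℚ {suc n} f = f zero + sumℚ (λ i → f (suc i))

dot : ∀ {n} → Vecℚ n → Vecℚ n → ℚ
dot x y = sumℚ (λ i → x i * y i)

_·_ : ∀ {n} → Matℚ n → Vecℚ n → Vecℚ n
(M · x) i = sumℚ (λ j → M i j * x j)

_⊕_ : ∀ {n} → Vecℚ n → Vecℚ n → Vecℚ n
(x ⊕ y) i = x i + y i

𝐞 : ∀ {n} → Vecℚ n
𝐞 _ = 1ℚ

Id : ∀ {n} → Matℚ n
Id i j with i ≟ j
... | yes _ = 1ℚ
... | no  _ = 0ℚ

_⊞_ : ∀ {n} → Matℚ n → Matℚ n → Matℚ n
(A ⊞ B) i j = A i j + B i j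

adjMatrix : ∀ {n} → SimpleGraph n → Matℚ n
adjMatrix G i j = if Adj G i j then 1ℚ else 0ℚ

IsLCPSolution : ∀ {n} → Matℚ n → Vecℚ n → Vecℚ n → Set
IsLCPSolution M q x =
  (∀ i → 0ℚ ≤ x i) × (∀ i → 0ℚ ≤ ((M · x) ⊕ q) i) × (dot x ((M · x) ⊕ q) ≡ 0ℚ)

WUnique : ∀ {n} → Matℚ n → Vecℚ n → Set
WUnique {n} M q = ∀ (x y : Vecℚ n) → IsLCPSolution M q x → IsLCPSolution M q y →
  ∀ i → ((M · x) ⊕ q) i ≡ ((M · y) ⊕ q) i

InSOL : ∀ {n} → SimpleGraph n → Vecℚ n → Set
InSOL G x = IsLCPSolution (adjMatrix G ⊞ Id) (λ i → - 𝐞 i) x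

Independent : ∀ {n} → SimpleGraph n → Subset n → Set
Independent G S = ∀ i j → i ∈ S → j ∈ S → Adj G i j ≡ false

MaximalIndependent : ∀ {n} → SimpleGraph n → Subset n → Set
MaximalIndependent {n} G S =
  Independent G S × (∀ (T : Subset n) → Independent G T → S ⊆ T → T ⊆ S)

WellCovered : ∀ {n} → SimpleGraph n → Set
WellCovered {n} G = ∀ (S T : Subset n) →
  MaximalIndependent G S → MaximalIndependent G T → ∣ S ∣ ≡ ∣ T ∣

{-# OPTIONS --safe #-}
module Submission where

-- If w = (A + I)x − e is the same for all solutions, complementarity xᵀw = 0 turns
-- xᵀ(A + I)y = xᵀ(w + e) into eᵀx for any two solutions x, y, and symmetry of A + I gives
-- eᵀx = eᵀy. The characteristic vector of a maximal independent set S is a solution: w vanishes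
-- on S by independence and is nonnegative off S since, by maximality, every vertex outside S has
-- a neighbour in S. Its coordinate sum is |S|.

open import Defs
open import Data.Nat using (ℕ)
open import Data.Rational using (ℚ; -_)
open import Data.Product using (_×_)
open import Relation.Binary.PropositionalEquality using (_≡_)

open import Algebra.Bundles using (Ring; CommutativeMonoid)
open import Data.Bool using (true; false; if_then_else_)
import Data.Bool.Properties as Bool
open import Data.Fin using (Fin; zero; suc)
open import Data.Fin.Properties using (any?; punchInᵢ≢i) renaming (_≟_ to _≟ᶠ_)
open import Data.Fin.Subset using (Subset; _∈_; _∉_; _∪_; ⁅_⁆; ∣_∣)
open import Data.Fin.Subset.Properties using (_∈?_; x∈p∪q⁻; x∈p∪q⁺; x∈⁅x⁆; x∈⁅y⁆⇒x≡y; p⊆p∪q)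
import Data.Nat as ℕ
import Data.Nat.Properties as ℕ
open import Data.Product using (_,_; ∃-syntax)
open import Data.Rational using (0ℚ; 1ℚ; _+_; _*_; _≤_; _<_; +-0-rawMonoid)
open import Data.Rational.Properties
open import Data.Sum using (inj₁; inj₂)
open import Data.Vec using ([]; _∷_; lookup)
open import Data.Vec.Properties using ([]=⇒lookup; lookup⇒[]=)
open import Data.Vec.Functional using (removeAt)
open import Function using (_∘_)
open import Relation.Binary using (tri<; tri≈; tri>)
open import Relation.Binary.PropositionalEquality as ≡
  using (refl; trans; cong; cong₂; subst; _≢_; module ≡-Reasoning)
open import Relation.Nullary using (yes; no; contradiction)
open import Relation.Nullary.Decidable using (_×-dec_)

open import Algebra.Definitions.RawMonoid +-0-rawMonoid using () renaming (_×_ to _×ℚ_)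
open import Algebra.Properties.Group +-0-group using (inverseʳ-unique)
open import Algebra.Properties.CommutativeSemigroup
  (CommutativeMonoid.commutativeSemigroup *-1-commutativeMonoid) using (x∙yz≈z∙yx)
open import Algebra.Properties.Semiring.Sum (Ring.semiring +-*-ring)
  using (sum; sum-cong-≗; sum-replicate-zero; sum-remove; ∑-distrib-+; ∑-comm; *-distribˡ-sum)

sumℚ≡sum : ∀ {n} (f : Vecℚ n) → sumℚ f ≡ sum f
sumℚ≡sum {ℕ.zero}  f = refl
sumℚ≡sum {ℕ.suc n} f = cong (f zero +_) (sumℚ≡sum (f ∘ suc))

sumℚ-cong : ∀ {n} {f g : Vecℚ n} → (∀ i → f i ≡ g i) → sumℚ f ≡ sumℚ g
sumℚ-cong {f = f} {g} f≗g = begin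
  sumℚ f ≡⟨ sumℚ≡sum f ⟩
  sum f  ≡⟨ sum-cong-≗ f≗g ⟩
  sum g  ≡⟨ sumℚ≡sum g ⟨
  sumℚ g ∎
  where open ≡-Reasoning

sumℚ-zero : ∀ {n} {f : Vecℚ n} → (∀ i → f i ≡ 0ℚ) → sumℚ f ≡ 0ℚ
sumℚ-zero {n} {f} f≗0 = begin
  sumℚ f              ≡⟨ sumℚ-cong f≗0 ⟩
  sumℚ {n} (λ _ → 0ℚ) ≡⟨ sumℚ≡sum {n} (λ _ → 0ℚ) ⟩
  sum {n} (λ _ → 0ℚ)  ≡⟨ sum-replicate-zero n ⟩
  0ℚ                  ∎
  where open ≡-Reasoning

sumℚ-distrib-+ : ∀ {n} (f g : Vecℚ n) → sumℚ (λ i → f i + g i) ≡ sumℚ f + sumℚ g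
sumℚ-distrib-+ f g = begin
  sumℚ (λ i → f i + g i) ≡⟨ sumℚ≡sum (λ i → f i + g i) ⟩
  sum (λ i → f i + g i)  ≡⟨ ∑-distrib-+ f g ⟩
  sum f + sum g          ≡⟨ cong₂ _+_ (sumℚ≡sum f) (sumℚ≡sum g) ⟨
  sumℚ f + sumℚ g        ∎
  where open ≡-Reasoning

*-distribˡ-sumℚ : ∀ {n} c (f : Vecℚ n) → c * sumℚ f ≡ sumℚ (λ i → c * f i)
*-distribˡ-sumℚ c f = begin
  c * sumℚ f             ≡⟨ cong (c *_) (sumℚ≡sum f) ⟩
  c * sum f              ≡⟨ *-distribˡ-sum c f ⟩
  sum (λ i → c * f i)    ≡⟨ sumℚ≡sum (λ i → c * f i) ⟨
  sumℚ (λ i → c * f i)   ∎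
  where open ≡-Reasoning

sumℚ-comm : ∀ {m n} (F : Fin m → Fin n → ℚ) →
            sumℚ (λ i → sumℚ (F i)) ≡ sumℚ (λ j → sumℚ (λ i → F i j))
sumℚ-comm F = begin
  sumℚ (λ i → sumℚ (F i))          ≡⟨ sumℚ²≡sum² F ⟩
  sum (λ i → sum (F i))            ≡⟨ ∑-comm F ⟩
  sum (λ j → sum (λ i → F i j))    ≡⟨ sumℚ²≡sum² (λ j i → F i j) ⟨
  sumℚ (λ j → sumℚ (λ i → F i j))  ∎
  where
  open ≡-Reasoning
  sumℚ²≡sum² : ∀ {m n} (H : Fin m → Fin n → ℚ) → sumℚ (λ i → sumℚ (H i)) ≡ sum (λ i → sum (H i))
  sumℚ²≡sum² H = trans (sumℚ-cong (sumℚ≡sum ∘ H)) (sumℚ≡sum (sum ∘ H))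

neg-distrib-sumℚ : ∀ {n} (f : Vecℚ n) → - sumℚ f ≡ sumℚ (λ i → - f i)
neg-distrib-sumℚ {ℕ.zero}  f = refl
neg-distrib-sumℚ {ℕ.suc n} f =
  trans (neg-distrib-+ (f zero) _) (cong (- f zero +_) (neg-distrib-sumℚ (f ∘ suc)))

sumℚ-nonneg : ∀ {n} {f : Vecℚ n} → (∀ i → 0ℚ ≤ f i) → 0ℚ ≤ sumℚ f
sumℚ-nonneg {ℕ.zero}  f≥0 = ≤-refl
sumℚ-nonneg {ℕ.suc n} f≥0 = +-mono-≤ (f≥0 zero) (sumℚ-nonneg (f≥0 ∘ suc))

≤-sumℚ : ∀ {n} {f : Vecℚ n} → (∀ i → 0ℚ ≤ f i) → ∀ k → f k ≤ sumℚ f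
≤-sumℚ {ℕ.suc n} {f} f≥0 k = begin
  f k                       ≡⟨ +-identityʳ (f k) ⟨
  f k + 0ℚ                  ≤⟨ +-monoʳ-≤ (f k) (sumℚ-nonneg {n} {removeAt f k} (λ i → f≥0 _)) ⟩
  f k + sumℚ (removeAt f k) ≡⟨ cong (f k +_) (sumℚ≡sum (removeAt f k)) ⟩
  f k + sum (removeAt f k)  ≡⟨ sum-remove f ⟨
  sum f                     ≡⟨ sumℚ≡sum f ⟨
  sumℚ f                    ∎
  where open ≤-Reasoning

sumℚ-δ : ∀ {n} {f : Vecℚ n} k → (∀ j → j ≢ k → f j ≡ 0ℚ) → sumℚ f ≡ f k
sumℚ-δ {ℕ.suc n} {f} k f≗0 = begin
  sumℚ f                     ≡⟨ sumℚ≡sum f ⟩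
  sum f                      ≡⟨ sum-remove f ⟩
  f k + sum (removeAt f k)   ≡⟨ cong (f k +_) (sumℚ≡sum (removeAt f k)) ⟨
  f k + sumℚ (removeAt f k)  ≡⟨ cong (f k +_) (sumℚ-zero (λ j → f≗0 _ (punchInᵢ≢i k j))) ⟩
  f k + 0ℚ                   ≡⟨ +-identityʳ (f k) ⟩
  f k                        ∎
  where open ≡-Reasoning

dot-congʳ : ∀ {n} (x : Vecℚ n) {u v : Vecℚ n} → (∀ i → u i ≡ v i) → dot x u ≡ dot x v
dot-congʳ x u≗v = sumℚ-cong (λ i → cong (x i *_) (u≗v i))

dot-comm : ∀ {n} (x y : Vecℚ n) → dot x y ≡ dot y x
dot-comm x y = sumℚ-cong (λ i → *-comm (x i) (y i))

dot-distribʳ-⊕ : ∀ {n} (x u v : Vecℚ n) → dot x (u ⊕ v) ≡ dot x u + dot x v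
dot-distribʳ-⊕ x u v = trans (sumℚ-cong (λ i → *-distribˡ-+ (x i) (u i) (v i)))
                             (sumℚ-distrib-+ (λ i → x i * u i) (λ i → x i * v i))

dot-negʳ : ∀ {n} (x y : Vecℚ n) → dot x (λ i → - y i) ≡ - dot x y
dot-negʳ x y = trans (sumℚ-cong (λ i → ≡.sym (neg-distribʳ-* (x i) (y i))))
                     (≡.sym (neg-distrib-sumℚ (λ i → x i * y i)))

IsSymmetric : ∀ {n} → Matℚ n → Set
IsSymmetric M = ∀ i j → M i j ≡ M j i

dot-·-symmetric : ∀ {n} {M : Matℚ n} → IsSymmetric M → ∀ x y → dot x (M · y) ≡ dot y (M · x)
dot-·-symmetric {M = M} M-sym x y = begin
  sumℚ (λ i → x i * sumℚ (λ j → M i j * y j))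
    ≡⟨ sumℚ-cong (λ i → *-distribˡ-sumℚ (x i) (λ j → M i j * y j)) ⟩
  sumℚ (λ i → sumℚ (λ j → x i * (M i j * y j)))
    ≡⟨ sumℚ-comm (λ i j → x i * (M i j * y j)) ⟩
  sumℚ (λ j → sumℚ (λ i → x i * (M i j * y j)))
    ≡⟨ sumℚ-cong (λ j → sumℚ-cong (λ i → swap j i)) ⟩
  sumℚ (λ j → sumℚ (λ i → y j * (M j i * x i)))
    ≡⟨ sumℚ-cong (λ j → *-distribˡ-sumℚ (y j) (λ i → M j i * x i)) ⟨
  sumℚ (λ j → y j * sumℚ (λ i → M j i * x i))
    ∎
  where
  open ≡-Reasoning
  swap : ∀ j i → x i * (M i j * y j) ≡ y j * (M j i * x i)
  swap j i = trans (cong (λ m → x i * (m * y j)) (M-sym i j)) (x∙yz≈z∙yx (x i) (M j i) (y j))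

⊞-symmetric : ∀ {n} {A B : Matℚ n} → IsSymmetric A → IsSymmetric B → IsSymmetric (A ⊞ B)
⊞-symmetric A-sym B-sym i j = cong₂ _+_ (A-sym i j) (B-sym i j)

⊞-· : ∀ {n} (A B : Matℚ n) x i → ((A ⊞ B) · x) i ≡ (A · x) i + (B · x) i
⊞-· A B x i = trans (sumℚ-cong (λ j → *-distribʳ-+ (x j) (A i j) (B i j)))
                    (sumℚ-distrib-+ (λ j → A i j * x j) (λ j → B i j * x j))

Id-diag : ∀ {n} (i : Fin n) → Id i i ≡ 1ℚ
Id-diag i with i ≟ᶠ i
... | yes _  = refl
... | no i≢i = contradiction refl i≢i

Id-offDiag : ∀ {n} {i j : Fin n} → i ≢ j → Id i j ≡ 0ℚ
Id-offDiag {i = i} {j} i≢j with i ≟ᶠ j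
... | yes i≡j = contradiction i≡j i≢j
... | no _    = refl

Id-symmetric : ∀ {n} → IsSymmetric (Id {n})
Id-symmetric i j with i ≟ᶠ j
... | yes refl = ≡.sym (Id-diag i)
... | no i≢j   = ≡.sym (Id-offDiag (i≢j ∘ ≡.sym))

Id-· : ∀ {n} (x : Vecℚ n) i → (Id · x) i ≡ x i
Id-· x i = begin
  sumℚ (λ j → Id i j * x j)  ≡⟨ sumℚ-δ i off-diagonal ⟩
  Id i i * x i               ≡⟨ cong (_* x i) (Id-diag i) ⟩
  1ℚ * x i                   ≡⟨ *-identityˡ (x i) ⟩
  x i                        ∎
  where
  open ≡-Reasoning
  off-diagonal : ∀ j → j ≢ i → Id i j * x j ≡ 0ℚ
  off-diagonal j j≢i = trans (cong (_* x j) (Id-offDiag (j≢i ∘ ≡.sym))) (*-zeroˡ (x j))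

module _ {n} {M : Matℚ n} {q : Vecℚ n} (wu : WUnique M q) where

  wUnique⇒dot-q≡-dot-· : ∀ {x y} → IsLCPSolution M q x → IsLCPSolution M q y →
                         dot x q ≡ - dot x (M · y)
  wUnique⇒dot-q≡-dot-· {x} {y} x-sol@(_ , _ , x⊥w) y-sol = inverseʳ-unique _ _ (begin
    dot x (M · y) + dot x q  ≡⟨ dot-distribʳ-⊕ x (M · y) q ⟨
    dot x ((M · y) ⊕ q)      ≡⟨ dot-congʳ x (wu y x y-sol x-sol) ⟩
    dot x ((M · x) ⊕ q)      ≡⟨ x⊥w ⟩
    0ℚ                       ∎)
    where open ≡-Reasoning

  wUnique⇒dot-q-constant : IsSymmetric M → ∀ {x y} → IsLCPSolution M q x → IsLCPSolution M q y →
                           dot x q ≡ dot y q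
  wUnique⇒dot-q-constant M-sym {x} {y} x-sol y-sol = begin
    dot x q          ≡⟨ wUnique⇒dot-q≡-dot-· x-sol y-sol ⟩
    - dot x (M · y)  ≡⟨ cong -_ (dot-·-symmetric M-sym x y) ⟩
    - dot y (M · x)  ≡⟨ wUnique⇒dot-q≡-dot-· y-sol x-sol ⟨
    dot y q          ∎
    where open ≡-Reasoning

dot-neg𝐞 : ∀ {n} (x : Vecℚ n) → dot x (λ i → - 𝐞 i) ≡ - dot 𝐞 x
dot-neg𝐞 x = trans (dot-negʳ x 𝐞) (cong -_ (dot-comm x 𝐞))

adjMatrix-symmetric : ∀ {n} (G : SimpleGraph n) → IsSymmetric (adjMatrix G)
adjMatrix-symmetric G i j = cong (λ b → if b then 1ℚ else 0ℚ) (SimpleGraph.sym G i j)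

wUnique⇒SOL-sum-constant : ∀ {n} (G : SimpleGraph n) → WUnique (adjMatrix G ⊞ Id) (λ i → - 𝐞 i) →
                           ∀ {x y} → InSOL G x → InSOL G y → dot 𝐞 x ≡ dot 𝐞 y
wUnique⇒SOL-sum-constant G wu {x} {y} x∈SOL y∈SOL = neg-injective (begin
  - dot 𝐞 x            ≡⟨ dot-neg𝐞 x ⟨
  dot x (λ i → - 𝐞 i)  ≡⟨ wUnique⇒dot-q-constant wu A+I-symmetric x∈SOL y∈SOL ⟩
  dot y (λ i → - 𝐞 i)  ≡⟨ dot-neg𝐞 y ⟩
  - dot 𝐞 y            ∎)
  where
  open ≡-Reasoning
  A+I-symmetric : IsSymmetric (adjMatrix G ⊞ Id)
  A+I-symmetric = ⊞-symmetric (adjMatrix-symmetric G) Id-symmetric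

0≤×1ℚ : ∀ m → 0ℚ ≤ m ×ℚ 1ℚ
0≤×1ℚ ℕ.zero    = ≤-refl
0≤×1ℚ (ℕ.suc m) = +-mono-≤ (nonNegative⁻¹ 1ℚ) (0≤×1ℚ m)

×1ℚ-mono-< : ∀ {m k} → m ℕ.< k → m ×ℚ 1ℚ < k ×ℚ 1ℚ
×1ℚ-mono-< {ℕ.zero}  {ℕ.suc k} _            = +-mono-<-≤ (positive⁻¹ 1ℚ) (0≤×1ℚ k)
×1ℚ-mono-< {ℕ.suc m} {ℕ.suc k} (ℕ.s≤s m<k) = +-monoʳ-< 1ℚ (×1ℚ-mono-< m<k)

×1ℚ-injective : ∀ {m k} → m ×ℚ 1ℚ ≡ k ×ℚ 1ℚ → m ≡ k
×1ℚ-injective {m} {k} eq with ℕ.<-cmp m k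
... | tri< m<k _ _ = contradiction eq (<⇒≢ (×1ℚ-mono-< m<k))
... | tri≈ _ m≡k _ = m≡k
... | tri> _ _ k<m = contradiction (≡.sym eq) (<⇒≢ (×1ℚ-mono-< k<m))

χ : ∀ {n} → Subset n → Vecℚ n
χ S i = if lookup S i then 1ℚ else 0ℚ

χ-∈ : ∀ {n} {S : Subset n} {i} → i ∈ S → χ S i ≡ 1ℚ
χ-∈ i∈S rewrite []=⇒lookup i∈S = refl

χ-∉ : ∀ {n} {S : Subset n} {i} → i ∉ S → χ S i ≡ 0ℚ
χ-∉ {S = S} {i} i∉S with lookup S i in S[i]
... | true  = contradiction (lookup⇒[]= i S S[i]) i∉S
... | false = refl

χ-nonneg : ∀ {n} (S : Subset n) i → 0ℚ ≤ χ S i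
χ-nonneg S i with lookup S i
... | true  = nonNegative⁻¹ 1ℚ
... | false = ≤-refl

dot-𝐞-χ : ∀ {n} (S : Subset n) → dot 𝐞 (χ S) ≡ ∣ S ∣ ×ℚ 1ℚ
dot-𝐞-χ []          = refl
dot-𝐞-χ (true ∷ S)  = cong (1ℚ +_) (dot-𝐞-χ S)
dot-𝐞-χ (false ∷ S) = trans (+-identityˡ _) (dot-𝐞-χ S)

module _ {n} (G : SimpleGraph n) where

  independent-∪-⁅⁆ : ∀ {S i} → Independent G S → (∀ j → j ∈ S → Adj G i j ≡ false) →
                     Independent G (S ∪ ⁅ i ⁆)
  independent-∪-⁅⁆ {S} {i} S-ind i-isolated a b a∈ b∈
    with x∈p∪q⁻ S ⁅ i ⁆ a∈ | x∈p∪q⁻ S ⁅ i ⁆ b∈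
  ... | inj₁ a∈S | inj₁ b∈S = S-ind a b a∈S b∈S
  ... | inj₁ a∈S | inj₂ b∈i rewrite x∈⁅y⁆⇒x≡y i b∈i =
    trans (SimpleGraph.sym G a i) (i-isolated a a∈S)
  ... | inj₂ a∈i | inj₁ b∈S rewrite x∈⁅y⁆⇒x≡y i a∈i = i-isolated b b∈S
  ... | inj₂ a∈i | inj₂ b∈i rewrite x∈⁅y⁆⇒x≡y i a∈i | x∈⁅y⁆⇒x≡y i b∈i = irrefl G i

  maximalIndependent⇒dominating : ∀ {S i} → MaximalIndependent G S → i ∉ S →
                                  ∃[ j ] j ∈ S × Adj G i j ≡ true
  maximalIndependent⇒dominating {S} {i} (S-ind , S-max) i∉S
    with any? (λ j → j ∈? S ×-dec Adj G i j Bool.≟ true)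
  ... | yes neighbour = neighbour
  ... | no ∄neighbour = contradiction (S∪i⊆S (x∈p∪q⁺ (inj₂ (x∈⁅x⁆ i)))) i∉S
    where
    i-isolated : ∀ j → j ∈ S → Adj G i j ≡ false
    i-isolated j j∈S = Bool.¬-not (λ i~j → ∄neighbour (j , j∈S , i~j))
    S∪i⊆S = S-max (S ∪ ⁅ i ⁆) (independent-∪-⁅⁆ S-ind i-isolated) (p⊆p∪q ⁅ i ⁆)

  adjMatrix-≡ : ∀ {i j b} → Adj G i j ≡ b → adjMatrix G i j ≡ (if b then 1ℚ else 0ℚ)
  adjMatrix-≡ = cong (λ b → if b then 1ℚ else 0ℚ)

  adjMatrix-*-nonneg : ∀ {x : Vecℚ n} → (∀ j → 0ℚ ≤ x j) → ∀ i j → 0ℚ ≤ adjMatrix G i j * x j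
  adjMatrix-*-nonneg {x} x≥0 i j with Adj G i j
  ... | true  = subst (0ℚ ≤_) (≡.sym (*-identityˡ (x j))) (x≥0 j)
  ... | false = ≤-reflexive (≡.sym (*-zeroˡ (x j)))

  independent⇒adjMatrix-·-χ≡0 : ∀ {S i} → Independent G S → i ∈ S → (adjMatrix G · χ S) i ≡ 0ℚ
  independent⇒adjMatrix-·-χ≡0 {S} {i} S-ind i∈S = sumℚ-zero term≡0
    where
    term≡0 : ∀ j → adjMatrix G i j * χ S j ≡ 0ℚ
    term≡0 j with j ∈? S
    ... | yes j∈S = trans (cong (_* χ S j) (adjMatrix-≡ (S-ind i j i∈S j∈S))) (*-zeroˡ (χ S j))
    ... | no j∉S  = trans (cong (adjMatrix G i j *_) (χ-∉ j∉S)) (*-zeroʳ (adjMatrix G i j))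

  neighbour⇒1≤adjMatrix-·-χ : ∀ {S i j} → j ∈ S → Adj G i j ≡ true → 1ℚ ≤ (adjMatrix G · χ S) i
  neighbour⇒1≤adjMatrix-·-χ {S} {i} {j} j∈S i~j = begin
    1ℚ                       ≡⟨ cong₂ _*_ (adjMatrix-≡ i~j) (χ-∈ j∈S) ⟨
    adjMatrix G i j * χ S j  ≤⟨ ≤-sumℚ (adjMatrix-*-nonneg (χ-nonneg S) i) j ⟩
    (adjMatrix G · χ S) i    ∎
    where open ≤-Reasoning

  slack : Vecℚ n → Vecℚ n
  slack x = ((adjMatrix G ⊞ Id) · x) ⊕ (λ i → - 𝐞 i)

  slack-≡ : ∀ x i → slack x i ≡ ((adjMatrix G · x) i + x i) + - 1ℚ
  slack-≡ x i = cong (_+ - 1ℚ) (begin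
    ((adjMatrix G ⊞ Id) · x) i           ≡⟨ ⊞-· (adjMatrix G) Id x i ⟩
    (adjMatrix G · x) i + (Id · x) i     ≡⟨ cong ((adjMatrix G · x) i +_) (Id-· x i) ⟩
    (adjMatrix G · x) i + x i            ∎)
    where open ≡-Reasoning

  independent⇒slack-χ≡0 : ∀ {S i} → Independent G S → i ∈ S → slack (χ S) i ≡ 0ℚ
  independent⇒slack-χ≡0 {S} {i} S-ind i∈S = trans (slack-≡ (χ S) i)
    (cong₂ (λ a b → (a + b) + - 1ℚ) (independent⇒adjMatrix-·-χ≡0 S-ind i∈S) (χ-∈ i∈S))

  maximalIndependent⇒slack-χ-nonneg : ∀ {S} → MaximalIndependent G S → ∀ i → 0ℚ ≤ slack (χ S) i
  maximalIndependent⇒slack-χ-nonneg {S} S-mis@(S-ind , _) i with i ∈? S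
  ... | yes i∈S = ≤-reflexive (≡.sym (independent⇒slack-χ≡0 S-ind i∈S))
  ... | no i∉S with maximalIndependent⇒dominating S-mis i∉S
  ...   | j , j∈S , i~j = begin
    0ℚ                  ≤⟨ +-monoˡ-≤ (- 1ℚ) (neighbour⇒1≤adjMatrix-·-χ j∈S i~j) ⟩
    a + - 1ℚ            ≡⟨ cong (_+ - 1ℚ) (+-identityʳ a) ⟨
    (a + 0ℚ) + - 1ℚ     ≡⟨ cong (λ b → (a + b) + - 1ℚ) (χ-∉ i∉S) ⟨
    (a + χ S i) + - 1ℚ  ≡⟨ slack-≡ (χ S) i ⟨
    slack (χ S) i       ∎
    where
    open ≤-Reasoning
    a = (adjMatrix G · χ S) i

  maximalIndependent⇒χ∈SOL : ∀ {S} → MaximalIndependent G S → InSOL G (χ S)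
  maximalIndependent⇒χ∈SOL {S} S-mis@(S-ind , _) =
    χ-nonneg S , maximalIndependent⇒slack-χ-nonneg S-mis , sumℚ-zero complementary
    where
    complementary : ∀ i → χ S i * slack (χ S) i ≡ 0ℚ
    complementary i with i ∈? S
    ... | yes i∈S = trans (cong (χ S i *_) (independent⇒slack-χ≡0 S-ind i∈S)) (*-zeroʳ (χ S i))
    ... | no i∉S  = trans (cong (_* slack (χ S) i) (χ-∉ i∉S)) (*-zeroˡ (slack (χ S) i))

lemma8 : ∀ (n : ℕ) (G : SimpleGraph n) →
    WUnique (adjMatrix G ⊞ Id) (λ i → - 𝐞 i) →
    (∀ (x y : Vecℚ n) → InSOL G x → InSOL G y → dot 𝐞 x ≡ dot 𝐞 y) × WellCovered G
lemma8 n G wu = (λ x y → SOL-sum-constant) , wellCovered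
  where
  SOL-sum-constant : ∀ {x y} → InSOL G x → InSOL G y → dot 𝐞 x ≡ dot 𝐞 y
  SOL-sum-constant = wUnique⇒SOL-sum-constant G wu

  χ∈SOL : ∀ {S} → MaximalIndependent G S → InSOL G (χ S)
  χ∈SOL = maximalIndependent⇒χ∈SOL G

  wellCovered : WellCovered G
  wellCovered S T S-mis T-mis = ×1ℚ-injective (begin
    ∣ S ∣ ×ℚ 1ℚ  ≡⟨ dot-𝐞-χ S ⟨
    dot 𝐞 (χ S)  ≡⟨ SOL-sum-constant (χ∈SOL S-mis) (χ∈SOL T-mis) ⟩
    dot 𝐞 (χ T)  ≡⟨ dot-𝐞-χ T ⟩
    ∣ T ∣ ×ℚ 1ℚ  ∎)
    where open ≡-Reasoning
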